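{- Let $G=(V,E,\Omega)$ be a finitely separable graph, $\Psi\subseteq\Omega$ and $\omega\in\Psi$. Let $\hat C=\hat C_\Psi(F,\omega)$ be a standard neighbourhood of $\omega$ in $|G|_\Psi$, i.e. either $\omega$ is undominated and $F$ is a finite bond, or $\omega$ is dominated by a vertex $v$ and $F$ is a $v$-cofinite $v$–$\omega$ bond. Then $[x]_\Psi\subseteq\hat C$ for every $x\in\hat C\setminus[\omega]_\Psi$.
   Context: A graph $G=(V,E,\Omega)$ consists of a vertex set $V$, an edge set $E$ (loops and multiple edges allowed) and its set $\Omega$ of ends, i.e. equivalence classes of rays, two rays being equivalent if no finite set of vertices separates them. $G$ is finitely separable if any two vertices can be separated by deleting finitely many edges. A bond is a minimal nonempty cut $E(V_1,V_2)$ (all edges between the parts of a bipartition $\{V_1,V_2\}$ of $V$). Topology: let $X$ be the 1-complex of $G$, each edge a copy of $[0,1]$; $\mathring F$ is the union of the interiors of the edges in $F$. The space $|G|$ has point set $X\cup\Omega$; a point $x\in X$ has as basic open neighbourhoods the open $\epsilon$-balls in $X$ with $\epsilon$ less than the distance from $x$ to the nearest vertex $\neq x$; for an end $\omega$ and finite $S\subseteq V$, let $C(S,\omega)$ be the component of $G-S$ containing a ray of $\omega$ and $\hat C(S,\omega)$ the set of vertices and inner points of edges contained in or incident with $C(S,\omega)$ together with the ends having a ray in $C(S,\omega)$; these form a neighbourhood basis of $\omega$. A vertex $v$ dominates an end $\omega$ if there are infinitely many paths from $v$ to some ray in $\omega$ meeting pairwise only in $v$. Let $\sim$ be the equivalence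 relation on points of $|G|$ generated by $v\sim\omega$ whenever $v$ dominates $\omega$. For $\Psi\subseteq\Omega$ let $|G|_\Psi=|G|\setminus(\Omega\setminus\Psi)$ (subspace topology); $[x]_\Psi$ denotes the $\sim$-class of a point $x$ of $|G|_\Psi$ within $|G|_\Psi$. Given a bond $F=E(V_1,V_2)$ and an end $\omega\in\Psi$ lying in the $|G|$-closure of $V_1$ but not of $V_2$, $\hat C_\Psi(F,\omega)$ denotes the union of the $|G|_\Psi$-closure of $G[V_1]$ with $\mathring F$. If moreover $v\in V_2$, $F$ is a $v$–$\omega$ bond; it is $v$-cofinite if $v$ is an endvertex of all but finitely many edges of $F$. -}

module Defs where

open import Data.Nat using (ℕ; suc; _≤_; _<_)
open import Data.Bool using (Bool; true; false)
open import Data.Product using (Σ; ∃; ∃₂; _×_; _,_; proj₁; proj₂)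
open import Data.Sum using (_⊎_)
open import Data.List using (List; []; _∷_; length)
open import Data.List.Membership.Propositional using (_∈_; _∉_)
open import Data.List.Relation.Unary.All using (All)
open import Data.List.Relation.Unary.Unique.Propositional using (Unique)
open import Relation.Binary.PropositionalEquality using (_≡_; _≢_)
open import Relation.Nullary using (¬_)

-- A multigraph (loops and parallel edges allowed): each edge has an
-- (ordered, for convenience) pair of endvertices.
record Graph : Set₁ where
  field
    V : Set
    E : Set
    endpoints : E → V × V

module _ (G : Graph) where
  open Graph G

  Links : E → V → V → Set
  Links e a b = endpoints e ≡ (a , b) ⊎ endpoints e ≡ (b , a)

  Incident : V → E → Set
  Incident v e = proj₁ (endpoints e) ≡ v ⊎ proj₂ (endpoints e) ≡ v

  data Walk (u : V) : V → Set where
    stay : Walk u u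
    step : ∀ {w x} → Walk u w → (e : E) → Links e w x → Walk u x

  verts : ∀ {u w} → Walk u w → List V
  verts {u} stay = u ∷ []
  verts (step {x = x} p e _) = x ∷ verts p

  edgesW : ∀ {u w} → Walk u w → List E
  edgesW stay = []
  edgesW (step p e _) = e ∷ edgesW p

  IsPath : ∀ {u w} → Walk u w → Set
  IsPath p = Unique (verts p)

  record Ray : Set where
    field
      vtx  : ℕ → V
      edge : ℕ → E
      link : ∀ n → Links (edge n) (vtx n) (vtx (suc n))
      inj  : ∀ m n → vtx m ≡ vtx n → m ≡ n
  open Ray public

  ConnAvoid : List V → V → V → Set
  ConnAvoid S a b = Σ (Walk a b) λ p → All (_∉ S) (verts p)

  TailAvoids : List V → Ray → ℕ → Set
  TailAvoids S r n = ∀ k → n ≤ k → vtx r k ∉ S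

  SameComp : List V → Ray → Ray → Set
  SameComp S r r' = ∃₂ λ n m → TailAvoids S r n × TailAvoids S r' m
                             × ConnAvoid S (vtx r n) (vtx r' m)

  -- equivalence of rays (ends are the classes): no finite S separates them
  EquivRay : Ray → Ray → Set
  EquivRay r r' = ∀ S → SameComp S r r'

  InC : List V → Ray → V → Set
  InC S r u = u ∉ S × ∃ λ n → TailAvoids S r n × ConnAvoid S u (vtx r n)

  -- the end of r lies in the |G|-closure of the vertex set P
  -- (every basic open neighbourhood Ĉ(S,r) meets P, i.e. every C(S,r) meets P)
  InClosure : (V → Set) → Ray → Set
  InClosure P r = ∀ S → ∃ λ u → P u × InC S r u

  record PathTo (v : V) (R : Ray) : Set where
    field
      idx     : ℕ
      walk    : Walk v (vtx R idx)
      isPath  : IsPath walk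
      nontriv : 0 < length (edgesW walk)
  open PathTo public

  Dominates : V → Ray → Set
  Dominates v r = Σ Ray λ R → EquivRay R r ×
    Σ (ℕ → PathTo v R) λ P →
      ∀ i j → i ≢ j → ∀ x → x ∈ verts (walk (P i)) → x ∈ verts (walk (P j)) → x ≡ v

  FinitelySeparable : Set
  FinitelySeparable = ∀ u w → u ≢ w →
    ∃ λ (L : List E) → ¬ (Σ (Walk u w) λ p → All (_∉ L) (edgesW p))

  -- a set of ends Ψ ⊆ Ω, given as a predicate on rays respecting equivalence
  RespectsEquiv : (Ray → Set) → Set
  RespectsEquiv Ψ = ∀ r r' → EquivRay r r' → Ψ r → Ψ r'

  -- bipartition {V₁, V₂} of V, V₁ = side⁻¹(true), V₂ = side⁻¹(false)
  V₁ : (V → Bool) → V → Set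
  V₁ side u = side u ≡ true

  V₂ : (V → Bool) → V → Set
  V₂ side u = side u ≡ false

  InCut : (V → Bool) → E → Set
  InCut side e = side (proj₁ (endpoints e)) ≢ side (proj₂ (endpoints e))

  IsBond : (V → Bool) → Set
  IsBond side = (∃ λ e → InCut side e) ×
    (∀ side' → (∃ λ e → InCut side' e) → (∀ e → InCut side' e → InCut side e) →
       ∀ e → InCut side e → InCut side' e)

  FiniteEdgeSet : (E → Set) → Set
  FiniteEdgeSet F = ∃ λ (L : List E) → ∀ e → F e → e ∈ L

  Cofinite : V → (E → Set) → Set
  Cofinite v F = ∃ λ (L : List E) → ∀ e → F e → e ∈ L ⊎ Incident v e

  module _ (Ψ : Ray → Set) where

    -- points of |G|_Ψ; the inner points of an edge e are all represented by
    -- innerP e (nothing in the statement distinguishes them)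
    data Point : Set where
      vtxP   : V → Point
      innerP : E → Point
      endP   : (r : Ray) → Ψ r → Point

    data Sim : Point → Point → Set where
      simV   : ∀ v → Sim (vtxP v) (vtxP v)
      simE   : ∀ e → Sim (innerP e) (innerP e)
      simEnd : ∀ r r' (p : Ψ r) (p' : Ψ r') → EquivRay r r' → Sim (endP r p) (endP r' p')
      simDom : ∀ v r (p : Ψ r) → Dominates v r → Sim (vtxP v) (endP r p)
      simSym : ∀ {x y} → Sim x y → Sim y x
      simTrans : ∀ {x y z} → Sim x y → Sim y z → Sim x z

    -- membership in Ĉ_Ψ(F,ω) = (|G|_Ψ-closure of G[V₁]) ∪ F̊,  F = E(V₁,V₂)
    InĈ : (V → Bool) → Point → Set
    InĈ side (vtxP u) = V₁ side u
    InĈ side (innerP e) =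
      (V₁ side (proj₁ (endpoints e)) × V₁ side (proj₂ (endpoints e))) ⊎ InCut side e
    InĈ side (endP r _) = InClosure (V₁ side) r

  StandardNbhd : (V → Bool) → Ray → Set
  StandardNbhd side ω =
    IsBond side × InClosure (V₁ side) ω × ¬ InClosure (V₂ side) ω ×
    ( ((¬ ∃ λ v → Dominates v ω) × FiniteEdgeSet (InCut side))
    ⊎ (∃ λ v → V₂ side v × Dominates v ω × Cofinite v (InCut side)))

-- If u is not ∼-equivalent to ω, the bond
-- F is met by every walk crossing it in a finite vertex set X avoiding u: the
-- endvertices of the finitely many edges of F not at the dominating vertex v of ω,
-- together with v itself.  The paths form a sunflower with kernel u, so only
-- finitely many of them can meet X, and infinitely many end on u's side of F.
-- Hence u ∈ V₁ iff r lies in the closure of V₁, i.e. each generating instance of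
-- ∼ away from [ω] preserves membership in Ĉ.
module Submission where

open import Defs
open import Data.Bool using (Bool; true)
open import Data.Bool.Properties using (_≟_)
open import Data.Nat using (ℕ; suc; _≤_; _<_; _≤′_; ≤′-reflexive; ≤′-step; _≤?_; _<?_)
open import Data.Nat.Properties using (≤-refl; ≤-trans; ≤-total; ≤⇒≤′; ≤′⇒≤; ≮⇒≥; <⇒≢)
open import Data.Fin using (Fin; toℕ)
open import Data.Fin.Properties using (pigeonhole; any?)
open import Data.Product using (Σ; ∃; _×_; _,_; proj₁; proj₂)
open import Data.Sum using (inj₁; inj₂)
open import Data.Empty using (⊥-elim)
open import Data.List using (List; _∷_; length; lookup; map; applyUpTo; _++_)
open import Data.List.Membership.Propositional using (_∈_; _∉_)
open import Data.List.Membership.Propositional.Properties using (∈-map⁺; ∈-++⁺ˡ; ∈-++⁺ʳ; ∈-applyUpTo⁺)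
open import Data.List.Relation.Unary.Any using (here; there; index)
open import Data.List.Relation.Unary.Any.Properties using (lookup-index)
open import Data.List.Relation.Unary.All using (All; _∷_; [])
  renaming (lookup to All-lookup)
open import Data.List.Relation.Unary.AllPairs using (_∷_)
open import Function using (_∘_; _∘′_)
open import Function.Bundles using (_⇔_; mk⇔; Equivalence)
open import Function.Properties.Equivalence
  renaming (refl to ⇔-refl; sym to ⇔-sym; trans to ⇔-trans)
open import Relation.Binary.PropositionalEquality
open import Relation.Nullary using (¬_; yes; no)
open import Relation.Nullary.Decidable using (_×-dec_)

Sunflower : {A : Set} → A → (ℕ → List A) → Set
Sunflower u W = ∀ i j → i ≢ j → ∀ x → x ∈ W i → x ∈ W j → x ≡ u

sunflower-petals-avoid : ∀ {A : Set} {u : A} {W : ℕ → List A} → Sunflower u W →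
  (Y : List A) → ¬ (∀ (i : Fin (suc (length Y))) → ∃ λ y → y ∈ Y × y ∈ W (toℕ i) × y ≢ u)
sunflower-petals-avoid {W = W} flower Y meets
  with i , j , i<j , same-index ← pigeonhole ≤-refl (λ i → index (proj₁ (proj₂ (meets i))))
  with yᵢ , yᵢ∈Y , yᵢ∈Wᵢ , yᵢ≢u ← meets i
     | yⱼ , yⱼ∈Y , yⱼ∈Wⱼ , _ ← meets j =
  yᵢ≢u (flower (toℕ i) (toℕ j) (<⇒≢ i<j) yᵢ yᵢ∈Wᵢ
                (subst (_∈ W (toℕ j)) (sym yᵢ≡yⱼ) yⱼ∈Wⱼ))
  where
    yᵢ≡yⱼ : yᵢ ≡ yⱼ
    yᵢ≡yⱼ = trans (lookup-index yᵢ∈Y)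
                  (trans (cong (lookup Y) same-index) (sym (lookup-index yⱼ∈Y)))

module _ (G : Graph) where
  open Graph G

  end-∈-verts : ∀ {a b} (p : Walk G a b) → b ∈ verts G p
  end-∈-verts stay = here refl
  end-∈-verts (step p e l) = here refl

  start-∈-verts : ∀ {a b} (p : Walk G a b) → a ∈ verts G p
  start-∈-verts stay = here refl
  start-∈-verts (step p e l) = there (start-∈-verts p)

  path-ends-differ : ∀ {a b} (p : Walk G a b) → IsPath G p → 0 < length (edgesW G p) → b ≢ a
  path-ends-differ (step p e l) (b≢verts ∷ _) _ = All-lookup b≢verts (start-∈-verts p)

  Links-sym : ∀ {e a b} → Links G e a b → Links G e b a
  Links-sym (inj₁ ends) = inj₂ ends
  Links-sym (inj₂ ends) = inj₁ ends

  Links-endpoints-∈ : ∀ {e a b} {xs : List V} → Links G e a b → a ∈ xs → b ∈ xs →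
    proj₁ (endpoints e) ∈ xs × proj₂ (endpoints e) ∈ xs
  Links-endpoints-∈ (inj₁ ends) a∈ b∈ rewrite ends = a∈ , b∈
  Links-endpoints-∈ (inj₂ ends) a∈ b∈ rewrite ends = b∈ , a∈

  module _ {S : List V} where

    ConnAvoid-refl : ∀ {a} → a ∉ S → ConnAvoid G S a a
    ConnAvoid-refl a∉S = stay , a∉S ∷ []

    ConnAvoid-step : ∀ {a b c} → ConnAvoid G S a b → (e : E) → Links G e b c → c ∉ S →
      ConnAvoid G S a c
    ConnAvoid-step (p , avoids) e l c∉S = step p e l , c∉S ∷ avoids

    ConnAvoid-trans : ∀ {a b c} → ConnAvoid G S a b → ConnAvoid G S b c → ConnAvoid G S a c
    ConnAvoid-trans ab (stay , _) = ab
    ConnAvoid-trans ab (step p e l , c∉S ∷ avoids) =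
      ConnAvoid-step (ConnAvoid-trans ab (p , avoids)) e l c∉S

    ConnAvoid-sym : ∀ {a b} → ConnAvoid G S a b → ConnAvoid G S b a
    ConnAvoid-sym (stay , avoids) = stay , avoids
    ConnAvoid-sym (step p e l , c∉S ∷ avoids) =
      ConnAvoid-trans
        (ConnAvoid-step (ConnAvoid-refl c∉S) e (Links-sym l) (All-lookup avoids (end-∈-verts p)))
        (ConnAvoid-sym (p , avoids))

    TailAvoids-≤ : ∀ r {m n} → m ≤ n → TailAvoids G S r m → TailAvoids G S r n
    TailAvoids-≤ _ m≤n avoids k n≤k = avoids k (≤-trans m≤n n≤k)

    ray-segment : ∀ r {m n} → TailAvoids G S r m → m ≤ n → ConnAvoid G S (vtx r m) (vtx r n)
    ray-segment r {m} avoids m≤n = segment (≤⇒≤′ m≤n)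
      where
        segment : ∀ {n} → m ≤′ n → ConnAvoid G S (vtx r m) (vtx r n)
        segment (≤′-reflexive refl) = ConnAvoid-refl (avoids m ≤-refl)
        segment (≤′-step {n} m≤′n) =
          ConnAvoid-step (segment m≤′n) (edge r n) (link r n)
                         (avoids (suc n) (≤′⇒≤ (≤′-step m≤′n)))

    tails-connected : ∀ r {m n} → TailAvoids G S r m → TailAvoids G S r n →
      ConnAvoid G S (vtx r m) (vtx r n)
    tails-connected r {m} {n} avoids-m avoids-n with ≤-total m n
    ... | inj₁ m≤n = ray-segment r avoids-m m≤n
    ... | inj₂ n≤m = ConnAvoid-sym (ray-segment r avoids-n n≤m)

    SameComp-sym : ∀ r r' → SameComp G S r r' → SameComp G S r' r
    SameComp-sym _ _ (n , m , t , t' , c) = m , n , t' , t , ConnAvoid-sym c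

    InC-transport : ∀ r r' {w} → SameComp G S r r' → InC G S r w → InC G S r' w
    InC-transport r r' (n₁ , m₁ , t₁ , t₁' , c) (w∉S , n , t , w-r) =
      w∉S , m₁ , t₁' , ConnAvoid-trans (ConnAvoid-trans w-r (tails-connected r t t₁)) c

    InC-connected : ∀ r {a b} → InC G S r a → InC G S r b → ConnAvoid G S a b
    InC-connected r (_ , _ , t , a-r) (_ , _ , t' , b-r) =
      ConnAvoid-trans a-r (ConnAvoid-trans (tails-connected r t t') (ConnAvoid-sym b-r))

    ray-eventually-InC : ∀ R r → SameComp G S R r → ∃ λ N → ∀ n → N ≤ n → InC G S r (vtx R n)
    ray-eventually-InC R r same@(N , _ , tR , _ , _) =
      N , λ n N≤n →
        InC-transport R r same (tR n N≤n , n , TailAvoids-≤ R N≤n tR , ConnAvoid-refl (tR n N≤n))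

  EquivRay-sym : ∀ r r' → EquivRay G r r' → EquivRay G r' r
  EquivRay-sym r r' r≈r' S = SameComp-sym r r' (r≈r' S)

  InClosure-respects-EquivRay : ∀ P r r' → EquivRay G r r' → InClosure G P r → InClosure G P r'
  InClosure-respects-EquivRay P r r' r≈r' closure S with u , Pu , u∈C ← closure S =
    u , Pu , InC-transport r r' (r≈r' S) u∈C

  Fan : V → Ray G → Set
  Fan u R = Σ (ℕ → PathTo G u R) λ P → Sunflower u (λ k → verts G (walk (P k)))

  endpointsOf : List E → List V
  endpointsOf L = map (proj₁ ∘′ endpoints) L ++ map (proj₂ ∘′ endpoints) L

  module _ (side : V → Bool) where

    Links-InCut : ∀ {e a b} → Links G e a b → side a ≢ side b → InCut G side e
    Links-InCut (inj₁ ends) a≁b rewrite ends = a≁b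
    Links-InCut (inj₂ ends) a≁b rewrite ends = a≁b ∘ sym

    walk-crosses-cut : ∀ {a b} (p : Walk G a b) → side a ≢ side b →
      ∃ λ e → InCut G side e × proj₁ (endpoints e) ∈ verts G p × proj₂ (endpoints e) ∈ verts G p
    walk-crosses-cut stay a≁a = ⊥-elim (a≁a refl)
    walk-crosses-cut {a} (step {w} p e l) a≁c with side a ≟ side w
    ... | no a≁w with e' , cut , e₁∈ , e₂∈ ← walk-crosses-cut p a≁w =
      e' , cut , there e₁∈ , there e₂∈
    ... | yes a∼w = e , Links-InCut l (λ w∼c → a≁c (trans a∼w w∼c)) ,
                    Links-endpoints-∈ l (there (end-∈-verts p)) (here refl)

    BlocksCrossings : V → List V → Set
    BlocksCrossings u X = ∀ {a b} (p : Walk G a b) → side a ≢ side b →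
      ∃ λ y → y ∈ X × y ∈ verts G p × y ≢ u

    listed-cut-edge-blocks : ∀ {a b} {e L} (p : Walk G a b) u → InCut G side e → e ∈ L →
      proj₁ (endpoints e) ∈ verts G p → proj₂ (endpoints e) ∈ verts G p →
      ∃ λ y → y ∈ endpointsOf L × y ∈ verts G p × y ≢ u
    listed-cut-edge-blocks {e = e} p u cut e∈L e₁∈p e₂∈p with side (proj₁ (endpoints e)) ≟ side u
    ... | no e₁≁u = _ , ∈-++⁺ˡ (∈-map⁺ _ e∈L) , e₁∈p , λ e₁≡u → e₁≁u (cong side e₁≡u)
    ... | yes e₁∼u = _ , ∈-++⁺ʳ _ (∈-map⁺ _ e∈L) , e₂∈p ,
                     λ e₂≡u → cut (trans e₁∼u (sym (cong side e₂≡u)))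

    finite-cut-blocks : FiniteEdgeSet G (InCut G side) → ∀ u → ∃ (BlocksCrossings u)
    finite-cut-blocks (L , listed) u = endpointsOf L , blocks
      where
        blocks : BlocksCrossings u (endpointsOf L)
        blocks p a≁b with e , cut , e₁∈ , e₂∈ ← walk-crosses-cut p a≁b =
          listed-cut-edge-blocks p u cut (listed e cut) e₁∈ e₂∈

    cofinite-cut-blocks : ∀ {v} → Cofinite G v (InCut G side) → ∀ u → v ≢ u → ∃ (BlocksCrossings u)
    cofinite-cut-blocks {v} (L , listed) u v≢u = v ∷ endpointsOf L , blocks
      where
        blocks : BlocksCrossings u (v ∷ endpointsOf L)
        blocks p a≁b with e , cut , e₁∈ , e₂∈ ← walk-crosses-cut p a≁b with listed e cut
        ... | inj₁ e∈L with y , y∈ , rest ← listed-cut-edge-blocks p u cut e∈L e₁∈ e₂∈ =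
          y , there y∈ , rest
        ... | inj₂ (inj₁ e₁≡v) = v , here refl , subst (_∈ _) e₁≡v e₁∈ , v≢u
        ... | inj₂ (inj₂ e₂≡v) = v , here refl , subst (_∈ _) e₂≡v e₂∈ , v≢u

    blocked-ConnAvoid-keeps-side : ∀ {u X a b} → BlocksCrossings u X → ConnAvoid G X a b →
      side a ≡ side b
    blocked-ConnAvoid-keeps-side {a = a} {b} blocks (p , avoids) with side a ≟ side b
    ... | yes a∼b = a∼b
    ... | no a≁b with y , y∈X , y∈p , _ ← blocks p a≁b = ⊥-elim (All-lookup avoids y∈p y∈X)

    fan-returns : ∀ {u X R} → BlocksCrossings u X → Fan u R → ∀ N →
      ∃ λ n → N ≤ n × side (vtx R n) ≡ side u
    fan-returns {u} {X} {R} blocks (P , flower) N = returning-petal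
      where
        Y : List V
        Y = applyUpTo (vtx R) N ++ X

        end : ℕ → ℕ
        end k = idx (P k)

        Returns : Fin (suc (length Y)) → Set
        Returns i = N ≤ end (toℕ i) × side (vtx R (end (toℕ i))) ≡ side u

        -- Petals ending before N meet Y at their endvertex, the others cross the cut.
        petal-meets : ∀ i → ¬ Returns i →
          ∃ λ y → y ∈ Y × y ∈ verts G (walk (P (toℕ i))) × y ≢ u
        petal-meets i ¬returns with Pᵢ ← P (toℕ i) with idx Pᵢ <? N
        ... | yes early = vtx R (idx Pᵢ) , ∈-++⁺ˡ (∈-applyUpTo⁺ (vtx R) early) ,
                          end-∈-verts (walk Pᵢ) , path-ends-differ (walk Pᵢ) (isPath Pᵢ) (nontriv Pᵢ)
        ... | no late
          with y , y∈X , rest ← blocks (walk Pᵢ) (λ u∼end → ¬returns (≮⇒≥ late , sym u∼end)) =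
          y , ∈-++⁺ʳ _ y∈X , rest

        returning-petal : ∃ λ n → N ≤ n × side (vtx R n) ≡ side u
        returning-petal
          with any? (λ i → (N ≤? end (toℕ i)) ×-dec (side (vtx R (end (toℕ i))) ≟ side u))
        ... | yes (i , returns) = end (toℕ i) , returns
        ... | no none =
          ⊥-elim (sunflower-petals-avoid flower Y (λ i → petal-meets i (λ returns → none (i , returns))))

    dominator-side : ∀ {u X} r → BlocksCrossings u X → Dominates G u r →
      side u ≡ true ⇔ InClosure G (V₁ G side) r
    dominator-side {u} {X} r blocks (R , R≈r , fan) = mk⇔ u∈V₁→closure closure→u∈V₁
      where
        u∈V₁→closure : side u ≡ true → InClosure G (V₁ G side) r
        u∈V₁→closure u∈V₁ S
          with N , eventually-in-C ← ray-eventually-InC R r (R≈r S)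
          with n , N≤n , n∼u ← fan-returns blocks fan N =
          vtx R n , trans n∼u u∈V₁ , eventually-in-C n N≤n

        closure→u∈V₁ : InClosure G (V₁ G side) r → side u ≡ true
        closure→u∈V₁ closure
          with w , w∈V₁ , w∈C ← closure X
          with N , eventually-in-C ← ray-eventually-InC R r (R≈r X)
          with n , N≤n , n∼u ← fan-returns blocks fan N = begin
            side u           ≡⟨ sym n∼u ⟩
            side (vtx R n)   ≡⟨ blocked-ConnAvoid-keeps-side blocks
                                    (InC-connected r (eventually-in-C n N≤n) w∈C) ⟩
            side w           ≡⟨ w∈V₁ ⟩
            true             ∎
          where open ≡-Reasoning

    module _ (Ψ : Ray G → Set) (ωP : Point G Ψ)
             (blocked : ∀ u → ¬ Sim G Ψ (vtxP u) ωP → ∃ (BlocksCrossings u)) where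

      InĈ-respects-Sim : ∀ {x y} → Sim G Ψ x y → ¬ Sim G Ψ x ωP → InĈ G Ψ side x ⇔ InĈ G Ψ side y
      InĈ-respects-Sim (simV v) _ = ⇔-refl
      InĈ-respects-Sim (simE e) _ = ⇔-refl
      InĈ-respects-Sim (simEnd r r' _ _ r≈r') _ =
        mk⇔ (InClosure-respects-EquivRay _ r r' r≈r')
            (InClosure-respects-EquivRay _ r' r (EquivRay-sym r r' r≈r'))
      InĈ-respects-Sim (simDom v r _ v-dom) v≁ω = dominator-side r (proj₂ (blocked v v≁ω)) v-dom
      InĈ-respects-Sim (simSym y∼x) x≁ω =
        ⇔-sym (InĈ-respects-Sim y∼x (λ y∼ω → x≁ω (simTrans (simSym y∼x) y∼ω)))
      InĈ-respects-Sim (simTrans x∼z z∼y) x≁ω =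
        ⇔-trans (InĈ-respects-Sim x∼z x≁ω)
                (InĈ-respects-Sim z∼y (λ z∼ω → x≁ω (simTrans x∼z z∼ω)))

  standard-nbhd-blocks : ∀ {side ω} Ψ (ωΨ : Ψ ω) → StandardNbhd G side ω →
    ∀ u → ¬ Sim G Ψ (vtxP u) (endP ω ωΨ) → ∃ (BlocksCrossings side u)
  standard-nbhd-blocks {side} _ _ (_ , _ , _ , inj₁ (_ , finite)) u _ = finite-cut-blocks side finite u
  standard-nbhd-blocks {side} {ω} Ψ ωΨ (_ , _ , _ , inj₂ (v , _ , v-dom , cofinite)) u u≁ω =
    cofinite-cut-blocks side cofinite u
      (λ v≡u → u≁ω (subst (λ z → Sim G Ψ (vtxP z) (endP ω ωΨ)) v≡u (simDom v ω ωΨ v-dom)))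

lemma10 : (G : Graph) → FinitelySeparable G →
    (Ψ : Ray G → Set) → RespectsEquiv G Ψ →
    (ω : Ray G) (ωΨ : Ψ ω) →
    (side : Graph.V G → Bool) → StandardNbhd G side ω →
    ∀ x → InĈ G Ψ side x → ¬ Sim G Ψ x (endP ω ωΨ) →
    ∀ y → Sim G Ψ y x → InĈ G Ψ side y
lemma10 G _ Ψ _ ω ωΨ side nbhd x x∈Ĉ x≁ω y y∼x =
  Equivalence.to
    (InĈ-respects-Sim G side Ψ (endP ω ωΨ) (standard-nbhd-blocks G Ψ ωΨ nbhd) (simSym y∼x) x≁ω)
    x∈Ĉ
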